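{- Let $a_0,\dots,a_{15}\in\mathbb{Z}$, with $b_k,c_k,e_k$ as in the context. If $e_0+e_4\not\equiv e_2+e_6$ and $e_1+e_5\not\equiv e_3+e_7\pmod 2$, then $$2(e_0e_4+e_2e_6+e_1e_5+e_3e_7)\equiv b_0b_2+b_1b_3+c_0c_2+c_1c_3\pmod 4.$$
   Context: For $0\le k\le 3$: $b_k := (a_k+a_{k+8})+(a_{k+4}+a_{k+12})$ and $c_k := (a_k+a_{k+8})-(a_{k+4}+a_{k+12})$. For $0\le k\le 7$: $e_k := a_k-a_{k+8}$. -}

module Defs where

open import Data.Nat using (ℕ)
open import Data.Fin using (Fin; zero; suc; #_)
open import Data.Fin.Patterns
open import Data.Integer using (ℤ; _+_; _-_; _*_; +_)
open import Data.Integer.Divisibility using (_∣_)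

_≡_[mod_] : ℤ → ℤ → ℕ → Set
x ≡ y [mod m ] = (+ m) ∣ (x - y)

infix 4 _≡_[mod_]

Seq16 : Set
Seq16 = Fin 16 → ℤ

b : Seq16 → Fin 4 → ℤ
b a 0F = (a (# 0) + a (# 8))  + (a (# 4) + a (# 12))
b a 1F = (a (# 1) + a (# 9))  + (a (# 5) + a (# 13))
b a 2F = (a (# 2) + a (# 10)) + (a (# 6) + a (# 14))
b a 3F = (a (# 3) + a (# 11)) + (a (# 7) + a (# 15))

c : Seq16 → Fin 4 → ℤ
c a 0F = (a (# 0) + a (# 8))  - (a (# 4) + a (# 12))
c a 1F = (a (# 1) + a (# 9))  - (a (# 5) + a (# 13))
c a 2F = (a (# 2) + a (# 10)) - (a (# 6) + a (# 14))
c a 3F = (a (# 3) + a (# 11)) - (a (# 7) + a (# 15))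

e : Seq16 → Fin 8 → ℤ
e a 0F = a (# 0) - a (# 8)
e a 1F = a (# 1) - a (# 9)
e a 2F = a (# 2) - a (# 10)
e a 3F = a (# 3) - a (# 11)
e a 4F = a (# 4) - a (# 12)
e a 5F = a (# 5) - a (# 13)
e a 6F = a (# 6) - a (# 14)
e a 7F = a (# 7) - a (# 15)

-- Write sₖ := aₖ + aₖ₊₈, so that bₖ = sₖ + sₖ₊₄ and cₖ = sₖ − sₖ₊₄. Then
-- b₀b₂ + c₀c₂ = 2(s₀s₂ + s₄s₆) and b₁b₃ + c₁c₃ = 2(s₁s₃ + s₅s₇), so it suffices to show
-- e₀e₄ + e₂e₆ + e₁e₅ + e₃e₇ ≡ s₀s₂ + s₄s₆ + s₁s₃ + s₅s₇ (mod 2). Modulo 2 we have sₖ ≡ eₖ,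
-- and e₀e₄ + e₂e₆ − (e₀e₂ + e₄e₆) = (e₀ − e₆)(e₄ − e₂) is even because the two factors
-- have odd sum (e₀ + e₄) − (e₂ + e₆); likewise for the odd indices.
module Submission where

open import Data.Fin using (Fin; #_; _↑ˡ_; _↑ʳ_)
open import Data.Fin.Patterns
open import Data.Integer using (ℤ; _+_; _-_; _*_; -_; +_; _%ℕ_; _/ℕ_)
open import Data.Integer.DivMod using (a≡a%ℕn+[a/ℕn]*n; n%ℕd<d)
open import Data.Integer.Divisibility.Signed
open import Data.Integer.Properties using (+-identityˡ; +-assoc; pos-*)
open import Data.Integer.Tactic.RingSolver using (solve-∀)
open import Data.Nat as ℕ using (ℕ)
open import Data.Sum using (_⊎_; inj₁; inj₂)
open import Relation.Binary.Bundles using (Setoid)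
open import Relation.Binary.PropositionalEquality
open import Relation.Nullary using (¬_; contradiction)
import Relation.Binary.Reasoning.Setoid as SetoidReasoning

open import Defs

-- x ≡ y [mod m ] as a record, so that x and y can be inferred from a proof
-- (the unsigned form unfolds to a statement about ∣ x - y ∣).
infix 4 _≅_[mod_]
record _≅_[mod_] (x y : ℤ) (m : ℕ) : Set where
  constructor congruent
  field +m∣x-y : + m ∣ x - y
open _≅_[mod_]

module _ {m : ℕ} where

  ≅⇒≡[mod] : ∀ {x y} → x ≅ y [mod m ] → x ≡ y [mod m ]
  ≅⇒≡[mod] x≅y = ∣⇒∣ᵤ (+m∣x-y x≅y)

  ≅-via : ∀ {x y d} → x - y ≡ d → + m ∣ d → x ≅ y [mod m ]
  ≅-via x-y≡d m∣d = congruent (subst (_ ∣_) (sym x-y≡d) m∣d)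

  ≡⇒≅ : ∀ {x y} → x ≡ y → x ≅ y [mod m ]
  ≡⇒≅ {x} refl = ≅-via (x-x≡0 x) (divides (+ 0) refl)
    where
    x-x≡0 : ∀ x → x - x ≡ + 0
    x-x≡0 = solve-∀

  ≅-sym : ∀ {x y} → x ≅ y [mod m ] → y ≅ x [mod m ]
  ≅-sym {x} {y} (congruent m∣x-y) = ≅-via (y-x≡-[x-y] x y) (∣m⇒∣-m m∣x-y)
    where
    y-x≡-[x-y] : ∀ x y → y - x ≡ - (x - y)
    y-x≡-[x-y] = solve-∀

  ≅-trans : ∀ {x y z} → x ≅ y [mod m ] → y ≅ z [mod m ] → x ≅ z [mod m ]
  ≅-trans {x} {y} {z} (congruent m∣x-y) (congruent m∣y-z) =
    ≅-via (telescope x y z) (∣m∣n⇒∣m+n m∣x-y m∣y-z)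
    where
    telescope : ∀ x y z → x - z ≡ (x - y) + (y - z)
    telescope = solve-∀

  ≅-setoid : Setoid _ _
  ≅-setoid = record
    { Carrier = ℤ
    ; _≈_ = _≅_[mod m ]
    ; isEquivalence = record { refl = ≡⇒≅ refl ; sym = ≅-sym ; trans = ≅-trans }
    }

  +-cong-≅ : ∀ {x x′ y y′} → x ≅ x′ [mod m ] → y ≅ y′ [mod m ] → x + y ≅ x′ + y′ [mod m ]
  +-cong-≅ {x} {x′} {y} {y′} (congruent m∣x-x′) (congruent m∣y-y′) =
    ≅-via (difference x x′ y y′) (∣m∣n⇒∣m+n m∣x-x′ m∣y-y′)
    where
    difference : ∀ x x′ y y′ → (x + y) - (x′ + y′) ≡ (x - x′) + (y - y′)
    difference = solve-∀

  *-cong-≅ : ∀ {x x′ y y′} → x ≅ x′ [mod m ] → y ≅ y′ [mod m ] → x * y ≅ x′ * y′ [mod m ]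
  *-cong-≅ {x} {x′} {y} {y′} (congruent m∣x-x′) (congruent m∣y-y′) =
    ≅-via (difference x x′ y y′) (∣m∣n⇒∣m+n (∣m⇒∣m*n y m∣x-x′) (∣n⇒∣m*n x′ m∣y-y′))
    where
    difference : ∀ x x′ y y′ → x * y - x′ * y′ ≡ (x - x′) * y + x′ * (y - y′)
    difference = solve-∀

  *-scale-≅ : ∀ k {x y} → x ≅ y [mod m ] → + k * x ≅ + k * y [mod k ℕ.* m ]
  *-scale-≅ k {x} {y} (congruent m∣x-y) =
    congruent (subst₂ _∣_ (sym (pos-* k m)) (distrib (+ k) x y) (*-monoʳ-∣ (+ k) m∣x-y))
    where
    distrib : ∀ k x y → k * (x - y) ≡ k * x - k * y
    distrib = solve-∀

even⊎odd : ∀ x → + 2 ∣ x ⊎ + 2 ∣ x - + 1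
even⊎odd x with x %ℕ 2 | a≡a%ℕn+[a/ℕn]*n x 2 | n%ℕd<d x 2
... | 0 | x≡2q | _ = inj₁ (divides (x /ℕ 2) (trans x≡2q (+-identityˡ _)))
... | 1 | x≡1+2q | _ = inj₂ (divides (x /ℕ 2) (trans (cong (_- + 1) x≡1+2q) (cancel (x /ℕ 2))))
  where
  cancel : ∀ q → + 1 + q * + 2 - + 1 ≡ q * + 2
  cancel = solve-∀
... | ℕ.suc (ℕ.suc _) | _ | ℕ.s≤s (ℕ.s≤s ())

odd-sum⇒even-product : ∀ x y → ¬ (+ 2 ∣ x + y) → + 2 ∣ x * y
odd-sum⇒even-product x y odd with even⊎odd x | even⊎odd y
... | inj₁ 2∣x | _ = ∣m⇒∣m*n y 2∣x
... | inj₂ _ | inj₁ 2∣y = ∣n⇒∣m*n x 2∣y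
... | inj₂ 2∣x-1 | inj₂ 2∣y-1 =
  contradiction (subst (_ ∣_) (sym (regroup x y)) (∣m∣n⇒∣m+n (∣m∣n⇒∣m+n 2∣x-1 2∣y-1) ∣-refl)) odd
  where
  regroup : ∀ x y → x + y ≡ (x - + 1) + (y - + 1) + + 2
  regroup = solve-∀

swap-products : ∀ x y z w → ¬ (x + y ≡ z + w [mod 2 ]) → x * y + z * w ≅ x * z + y * w [mod 2 ]
swap-products x y z w x+y≢z+w = ≅-via (factor x y z w)
  (odd-sum⇒even-product (x - w) (y - z)
    (λ 2∣sum → x+y≢z+w (≅⇒≡[mod] {2} {x + y} {z + w} (≅-via (regroup x y z w) 2∣sum))))
  where
  factor : ∀ x y z w → x * y + z * w - (x * z + y * w) ≡ (x - w) * (y - z)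
  factor = solve-∀
  regroup : ∀ x y z w → x + y - (z + w) ≡ (x - w) + (y - z)
  regroup = solve-∀

x-y≅x+y[mod2] : ∀ x y → x - y ≅ x + y [mod 2 ]
x-y≅x+y[mod2] x y = ≅-via (difference x y) (divides (- y) refl)
  where
  difference : ∀ x y → x - y - (x + y) ≡ - y * + 2
  difference = solve-∀

s : Seq16 → Fin 8 → ℤ
s a k = a (k ↑ˡ 8) + a (8 ↑ʳ k)

e≅s[mod2] : ∀ a k → e a k ≅ s a k [mod 2 ]
e≅s[mod2] a 0F = x-y≅x+y[mod2] (a (# 0)) (a (# 8))
e≅s[mod2] a 1F = x-y≅x+y[mod2] (a (# 1)) (a (# 9))
e≅s[mod2] a 2F = x-y≅x+y[mod2] (a (# 2)) (a (# 10))
e≅s[mod2] a 3F = x-y≅x+y[mod2] (a (# 3)) (a (# 11))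
e≅s[mod2] a 4F = x-y≅x+y[mod2] (a (# 4)) (a (# 12))
e≅s[mod2] a 5F = x-y≅x+y[mod2] (a (# 5)) (a (# 13))
e≅s[mod2] a 6F = x-y≅x+y[mod2] (a (# 6)) (a (# 14))
e≅s[mod2] a 7F = x-y≅x+y[mod2] (a (# 7)) (a (# 15))

sums*sums+diffs*diffs : ∀ p₀ p₁ p₂ p₃ q₀ q₁ q₂ q₃ →
  (p₀ + q₀) * (p₂ + q₂) + (p₁ + q₁) * (p₃ + q₃) + (p₀ - q₀) * (p₂ - q₂) + (p₁ - q₁) * (p₃ - q₃)
    ≡ + 2 * ((p₀ * p₂ + q₀ * q₂) + (p₁ * p₃ + q₁ * q₃))
sums*sums+diffs*diffs = solve-∀

e-products≅s-products[mod2] : ∀ a →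
  ¬ (e a 0F + e a 4F ≡ e a 2F + e a 6F [mod 2 ]) →
  ¬ (e a 1F + e a 5F ≡ e a 3F + e a 7F [mod 2 ]) →
  e a 0F * e a 4F + e a 2F * e a 6F + e a 1F * e a 5F + e a 3F * e a 7F
    ≅ (s a 0F * s a 2F + s a 4F * s a 6F) + (s a 1F * s a 3F + s a 5F * s a 7F) [mod 2 ]
e-products≅s-products[mod2] a evens-odd odds-odd = begin
  e a 0F * e a 4F + e a 2F * e a 6F + e a 1F * e a 5F + e a 3F * e a 7F
    ≡⟨ +-assoc (e a 0F * e a 4F + e a 2F * e a 6F) _ _ ⟩
  (e a 0F * e a 4F + e a 2F * e a 6F) + (e a 1F * e a 5F + e a 3F * e a 7F)
    ≈⟨ +-cong-≅ (swap-products (e a 0F) (e a 4F) (e a 2F) (e a 6F) evens-odd)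
                (swap-products (e a 1F) (e a 5F) (e a 3F) (e a 7F) odds-odd) ⟩
  (e a 0F * e a 2F + e a 4F * e a 6F) + (e a 1F * e a 3F + e a 5F * e a 7F)
    ≈⟨ +-cong-≅ (+-cong-≅ (e*e≅s*s 0F 2F) (e*e≅s*s 4F 6F)) (+-cong-≅ (e*e≅s*s 1F 3F) (e*e≅s*s 5F 7F)) ⟩
  (s a 0F * s a 2F + s a 4F * s a 6F) + (s a 1F * s a 3F + s a 5F * s a 7F) ∎
  where
  open SetoidReasoning (≅-setoid {2})
  e*e≅s*s : ∀ i j → e a i * e a j ≅ s a i * s a j [mod 2 ]
  e*e≅s*s i j = *-cong-≅ (e≅s[mod2] a i) (e≅s[mod2] a j)

lemma4p4 : (a : Seq16) →
    ¬ (e a 0F + e a 4F ≡ e a 2F + e a 6F [mod 2 ]) →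
    ¬ (e a 1F + e a 5F ≡ e a 3F + e a 7F [mod 2 ]) →
    (+ 2) * (e a 0F * e a 4F + e a 2F * e a 6F + e a 1F * e a 5F + e a 3F * e a 7F)
      ≡ b a 0F * b a 2F + b a 1F * b a 3F + c a 0F * c a 2F + c a 1F * c a 3F [mod 4 ]
lemma4p4 a evens-odd odds-odd = ≅⇒≡[mod] (≅-trans
  (*-scale-≅ 2 (e-products≅s-products[mod2] a evens-odd odds-odd))
  (≡⇒≅ (sym (sums*sums+diffs*diffs (s a 0F) (s a 1F) (s a 2F) (s a 3F) (s a 4F) (s a 5F) (s a 6F) (s a 7F)))))
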